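{- Let $\gamma$ be a curve of a region $\mathcal{R}$, let $\beta=(\beta_1,\beta_2,\beta_3)\in\mathbb{B}$, and let $u=a\beta_1+b\beta_2+c\beta_3\in\mathbb{R}^3$. If $\|u\|<1$ and $abc\neq0$, then the curves $\gamma$ and $\gamma+u$ (the translate $s\mapsto\gamma(s)+u$) are disjoint.
   Context: A basic cube is $(x,y,z)+[0,1]^3$, $(x,y,z)\in\mathbb{Z}^3$; a region is a finite union of basic cubes. $\Phi=\{\pm e_x,\pm e_y,\pm e_z\}$; $\mathbb{B}$ is the set of ordered triples $(\beta_1,\beta_2,\beta_3)$ of vectors of $\Phi$ with $\beta_1\cdot(\beta_2\times\beta_3)=1$. A segment of $\mathcal{R}$ is a map $\ell:[0,1]\to\mathbb{R}^3$, $\ell(s)=p_0+(p_1-p_0)s$, where $p_0,p_1$ are centers of two cubes of $\mathcal{R}$ sharing a face. A curve of $\mathcal{R}$ is a map $\gamma:[0,n]\to\mathbb{R}^3$ ($n\in\mathbb{Z}_{>0}$) such that each restriction $s\mapsto\gamma(k+s)$, $s\in[0,1]$, $k=0,\dots,n-1$, is a segment of $\mathcal{R}$. Disjoint means the images do not intersect. -}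

module Defs where

open import Data.Nat using (ℕ; zero; suc)
open import Data.Integer as ℤ using (ℤ; +_; -[1+_])
open import Data.Fin using (Fin; inject₁) renaming (suc to fsuc)
open import Data.List using (List)
open import Data.List.Membership.Propositional using (_∈_)
open import Data.Product using (Σ; ∃; _×_; _,_)
open import Data.Sum using (_⊎_)
open import Relation.Nullary using (¬_)
open import Relation.Binary.PropositionalEquality using (_≡_)
open import Algebra.Structures using (IsCommutativeRing)
open import Relation.Binary.Structures using (IsStrictTotalOrder)

-- The real numbers, axiomatised as a (Dedekind-)complete ordered field.
-- Every such structure is isomorphic to ℝ; the theorem is stated for
-- every such structure.  `half` is the (unique) element with
-- half + half = 1, included for convenience to define cube centres.

record RealField : Set₁ where
  infixl 6 _+_
  infixl 7 _*_
  infix 4 _<_ _≤_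
  field
    Carrier : Set
    0r 1r   : Carrier
    _+_ _*_ : Carrier → Carrier → Carrier
    -_      : Carrier → Carrier
    _<_     : Carrier → Carrier → Set
    isCommutativeRing : IsCommutativeRing _≡_ _+_ _*_ -_ 0r 1r
    0≢1     : ¬ (0r ≡ 1r)
    inverse : ∀ x → ¬ (x ≡ 0r) → ∃ λ y → x * y ≡ 1r
    isStrictTotalOrder : IsStrictTotalOrder _≡_ _<_
    +-mono-< : ∀ {x y} z → x < y → x + z < y + z
    *-pos    : ∀ {x y} → 0r < x → 0r < y → 0r < x * y
  _≤_ : Carrier → Carrier → Set
  x ≤ y = x < y ⊎ x ≡ y
  field
    complete : (P : Carrier → Set) → (∃ λ x → P x) →
               (∃ λ b → ∀ x → P x → x ≤ b) →
               ∃ λ s → (∀ x → P x → x ≤ s) ×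
                       (∀ b → (∀ x → P x → x ≤ b) → s ≤ b)
    half     : Carrier
    half-spec : half + half ≡ 1r

ℤ³ : Set
ℤ³ = ℤ × ℤ × ℤ

_+ℤ³_ : ℤ³ → ℤ³ → ℤ³
(a , b , c) +ℤ³ (d , e , f) = (a ℤ.+ d , b ℤ.+ e , c ℤ.+ f)

data Φ : Set where
  +ex -ex +ey -ey +ez -ez : Φ

vec : Φ → ℤ³
vec +ex = (ℤ.1ℤ , ℤ.0ℤ , ℤ.0ℤ)
vec -ex = (ℤ.-1ℤ , ℤ.0ℤ , ℤ.0ℤ)
vec +ey = (ℤ.0ℤ , ℤ.1ℤ , ℤ.0ℤ)
vec -ey = (ℤ.0ℤ , ℤ.-1ℤ , ℤ.0ℤ)
vec +ez = (ℤ.0ℤ , ℤ.0ℤ , ℤ.1ℤ)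
vec -ez = (ℤ.0ℤ , ℤ.0ℤ , ℤ.-1ℤ)

dotℤ : ℤ³ → ℤ³ → ℤ
dotℤ (a , b , c) (d , e , f) = a ℤ.* d ℤ.+ b ℤ.* e ℤ.+ c ℤ.* f

crossℤ : ℤ³ → ℤ³ → ℤ³
crossℤ (a , b , c) (d , e , f) =
  (b ℤ.* f ℤ.- c ℤ.* e , c ℤ.* d ℤ.- a ℤ.* f , a ℤ.* e ℤ.- b ℤ.* d)

𝔹 : Set
𝔹 = Σ (Φ × Φ × Φ) λ { (β₁ , β₂ , β₃) →
      dotℤ (vec β₁) (crossℤ (vec β₂) (vec β₃)) ≡ ℤ.1ℤ }

-- A region: finite union of basic cubes (x,y,z)+[0,1]^3, given by the
-- list of their integer corners (x,y,z).
Region : Set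
Region = List ℤ³

ShareFace : ℤ³ → ℤ³ → Set
ShareFace p q = ∃ λ (e : Φ) → q ≡ p +ℤ³ vec e

-- A curve γ : [0,n] → ℝ³ of R is determined by the sequence of cubes
-- c₀,…,cₙ whose centres are γ(0),…,γ(n); γ(k+s) = p_k + (p_{k+1}-p_k)s.
record Curve (reg : Region) : Set where
  field
    n        : ℕ
    n-pos    : ¬ (n ≡ 0)
    cube     : Fin (suc n) → ℤ³
    cube∈    : ∀ i → cube i ∈ reg
    adjacent : ∀ (k : Fin n) → ShareFace (cube (inject₁ k)) (cube (fsuc k))

module Geometry (F : RealField) where
  open RealField F

  ℝ³ : Set
  ℝ³ = Carrier × Carrier × Carrier

  fromℕ : ℕ → Carrier
  fromℕ zero    = 0r
  fromℕ (suc n) = 1r + fromℕ n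

  fromℤ : ℤ → Carrier
  fromℤ (+ n)      = fromℕ n
  fromℤ -[1+ n ]   = - fromℕ (suc n)

  _⊕_ : ℝ³ → ℝ³ → ℝ³
  (a , b , c) ⊕ (d , e , f) = (a + d , b + e , c + f)

  _⊙_ : Carrier → ℝ³ → ℝ³
  s ⊙ (a , b , c) = (s * a , s * b , s * c)

  ⊖_ : ℝ³ → ℝ³
  ⊖ (a , b , c) = (- a , - b , - c)

  embed : ℤ³ → ℝ³
  embed (a , b , c) = (fromℤ a , fromℤ b , fromℤ c)

  -- Euclidean norm: ‖u‖ < 1 ⇔ ‖u‖² = u·u < 1
  normSq : ℝ³ → Carrier
  normSq (a , b , c) = a * a + b * b + c * c

  centre : ℤ³ → ℝ³
  centre (a , b , c) = (fromℤ a + half , fromℤ b + half , fromℤ c + half)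

  InUnit : Carrier → Set
  InUnit s = 0r ≤ s × s ≤ 1r

  point : ∀ {reg} (γ : Curve reg) → Fin (Curve.n γ) → Carrier → ℝ³
  point γ k s = p ⊕ (s ⊙ (q ⊕ (⊖ p)))
    where
    p = centre (Curve.cube γ (inject₁ k))
    q = centre (Curve.cube γ (fsuc k))

  combo : 𝔹 → Carrier → Carrier → Carrier → ℝ³
  combo ((β₁ , β₂ , β₃) , _) a b c =
    ((a ⊙ embed (vec β₁)) ⊕ (b ⊙ embed (vec β₂))) ⊕ (c ⊙ embed (vec β₃))

  DisjointTranslate : ∀ {reg} → Curve reg → ℝ³ → Set
  DisjointTranslate γ u =
    ∀ (k l : Fin (Curve.n γ)) (s t : Carrier) → InUnit s → InUnit t →
      ¬ (point γ k s ≡ point γ l t ⊕ u)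

module _ (F : RealField) where
  open RealField F
  open Geometry F

  Lemma4p5 : Set
  Lemma4p5 =
    ∀ (reg : Region) (γ : Curve reg) (β : 𝔹) (a b c : Carrier) →
    normSq (combo β a b c) < 1r → ¬ (a * b * c ≡ 0r) →
    DisjointTranslate γ (combo β a b c)

-- If γ(k + s) = γ(l + t) + u, the two segments involved run along at most two
-- coordinate axes, so along a third axis both points sit at cube centres: their
-- coordinates are m + 1/2 and n + 1/2 with m, n integers.  Hence that
-- coordinate of u is the integer m − n, and ‖u‖ < 1 forces it to be 0.  Since
-- β₁, β₂, β₃ are the rows of a signed permutation matrix, every coordinate of
-- u = aβ₁ + bβ₂ + cβ₃ is ±a, ±b or ±c, so abc = 0.
module Submission where

open import Defs
open import Data.Integer as ℤ using (-[1+_])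
import Data.Integer.Properties as ℤ
open import Data.Nat as ℕ using (zero; suc; z≤n; s≤s)
open import Data.Fin using (Fin; inject₁) renaming (suc to fsuc)
open import Data.List using (List; []; _∷_)
open import Data.List.Membership.Propositional using (_∈_)
open import Data.List.Relation.Unary.All as All using (All; all?)
open import Data.List.Relation.Unary.Any using (Any; any?; here; there; satisfied)
open import Data.Product using (∃; _×_; _,_; proj₁; proj₂)
open import Data.Product.Properties using (≡-dec)
open import Data.Sum using (inj₁; inj₂)
open import Data.Empty using (⊥-elim)
open import Relation.Nullary.Decidable using (_→-dec_; toWitness)
open import Relation.Binary.Definitions using (DecidableEquality; tri<; tri≈; tri>)
open import Relation.Binary.PropositionalEquality
open import Relation.Binary.Bundles using (StrictPartialOrder)
open import Relation.Binary.Structures using (IsStrictTotalOrder)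
open import Algebra.Bundles using (CommutativeRing)
open import Algebra.Structures using (IsCommutativeRing)
import Algebra.Properties.Ring as RingProperties
import Algebra.Properties.AbelianGroup as AbelianGroupProperties
import Algebra.Properties.CommutativeSemigroup as CommutativeSemigroupProperties
open import Function using (_∘_)
import Relation.Binary.Reasoning.StrictPartialOrder as StrictReasoning

data Axis : Set where
  X Y Z : Axis

coord : {A : Set} → Axis → A × A × A → A
coord X (p , _ , _) = p
coord Y (_ , q , _) = q
coord Z (_ , _ , r) = r

axis : Φ → Axis
axis +ex = X
axis -ex = X
axis +ey = Y
axis -ey = Y
axis +ez = Z
axis -ez = Z

thirdAxis : (i j : Axis) → ∃ λ k → i ≢ k × j ≢ k
thirdAxis X X = Y , (λ ()) , (λ ())
thirdAxis X Y = Z , (λ ()) , (λ ())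
thirdAxis X Z = Y , (λ ()) , (λ ())
thirdAxis Y X = Z , (λ ()) , (λ ())
thirdAxis Y Y = X , (λ ()) , (λ ())
thirdAxis Y Z = X , (λ ()) , (λ ())
thirdAxis Z X = Y , (λ ()) , (λ ())
thirdAxis Z Y = X , (λ ()) , (λ ())
thirdAxis Z Z = X , (λ ()) , (λ ())

coord-+ℤ³ : ∀ i p q → coord i (p +ℤ³ q) ≡ coord i p ℤ.+ coord i q
coord-+ℤ³ X p q = refl
coord-+ℤ³ Y p q = refl
coord-+ℤ³ Z p q = refl

coord-vec-off-axis : ∀ e {i} → axis e ≢ i → coord i (vec e) ≡ ℤ.0ℤ
coord-vec-off-axis +ex {X} off = ⊥-elim (off refl)
coord-vec-off-axis -ex {X} off = ⊥-elim (off refl)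
coord-vec-off-axis +ey {Y} off = ⊥-elim (off refl)
coord-vec-off-axis -ey {Y} off = ⊥-elim (off refl)
coord-vec-off-axis +ez {Z} off = ⊥-elim (off refl)
coord-vec-off-axis -ez {Z} off = ⊥-elim (off refl)
coord-vec-off-axis +ex {Y} _ = refl
coord-vec-off-axis +ex {Z} _ = refl
coord-vec-off-axis -ex {Y} _ = refl
coord-vec-off-axis -ex {Z} _ = refl
coord-vec-off-axis +ey {X} _ = refl
coord-vec-off-axis +ey {Z} _ = refl
coord-vec-off-axis -ey {X} _ = refl
coord-vec-off-axis -ey {Z} _ = refl
coord-vec-off-axis +ez {X} _ = refl
coord-vec-off-axis +ez {Y} _ = refl
coord-vec-off-axis -ez {X} _ = refl
coord-vec-off-axis -ez {Y} _ = refl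

coord-step-off-axis : ∀ e {i} → axis e ≢ i → ∀ p → coord i (p +ℤ³ vec e) ≡ coord i p
coord-step-off-axis e {i} off p = begin
  coord i (p +ℤ³ vec e)            ≡⟨ coord-+ℤ³ i p (vec e) ⟩
  coord i p ℤ.+ coord i (vec e)    ≡⟨ cong (λ d → coord i p ℤ.+ d) (coord-vec-off-axis e off) ⟩
  coord i p ℤ.+ ℤ.0ℤ               ≡⟨ ℤ.+-identityʳ (coord i p) ⟩
  coord i p                        ∎
  where open ≡-Reasoning

direction : ∀ {reg} (γ : Curve reg) → Fin (Curve.n γ) → Φ
direction γ k = proj₁ (Curve.adjacent γ k)

allAxes : List Axis
allAxes = X ∷ Y ∷ Z ∷ []

∈allAxes : ∀ i → i ∈ allAxes
∈allAxes X = here refl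
∈allAxes Y = there (here refl)
∈allAxes Z = there (there (here refl))

allΦ : List Φ
allΦ = +ex ∷ -ex ∷ +ey ∷ -ey ∷ +ez ∷ -ez ∷ []

∈allΦ : ∀ e → e ∈ allΦ
∈allΦ +ex = here refl
∈allΦ -ex = there (here refl)
∈allΦ +ey = there (there (here refl))
∈allΦ -ey = there (there (there (here refl)))
∈allΦ +ez = there (there (there (there (here refl))))
∈allΦ -ez = there (there (there (there (there (here refl)))))

_≟ℤ³_ : DecidableEquality ℤ³
_≟ℤ³_ = ≡-dec ℤ._≟_ (≡-dec ℤ._≟_ ℤ._≟_)

column : Φ × Φ × Φ → Axis → ℤ³
column (β₁ , β₂ , β₃) i = coord i (vec β₁) , coord i (vec β₂) , coord i (vec β₃)

ColumnsInΦ : Φ × Φ × Φ → Set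
ColumnsInΦ β = All (λ i → Any (λ e → column β i ≡ vec e) allΦ) allAxes

-- A triple in 𝔹 is a positively oriented orthonormal frame, so its matrix is a
-- signed permutation matrix; checked by evaluation over all 216 triples.  Kept
-- opaque: unfolding the decision procedure during unification exhausts memory.
opaque
  𝔹⇒columnsInΦ : ∀ β₁ β₂ β₃ → dotℤ (vec β₁) (crossℤ (vec β₂) (vec β₃)) ≡ ℤ.1ℤ →
                 ColumnsInΦ (β₁ , β₂ , β₃)
  𝔹⇒columnsInΦ β₁ β₂ β₃ =
    All.lookup (All.lookup (All.lookup checked (∈allΦ β₁)) (∈allΦ β₂)) (∈allΦ β₃)
    where
    checked : All (λ β₁ → All (λ β₂ → All (λ β₃ →
                dotℤ (vec β₁) (crossℤ (vec β₂) (vec β₃)) ≡ ℤ.1ℤ → ColumnsInΦ (β₁ , β₂ , β₃))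
                allΦ) allΦ) allΦ
    checked = toWitness {a? = all? (λ β₁ → all? (λ β₂ → all? (λ β₃ →
      (_ ℤ.≟ _) →-dec all? (λ i → any? (λ e → column (β₁ , β₂ , β₃) i ≟ℤ³ vec e) allΦ) allAxes)
      allΦ) allΦ) allΦ} _

column-∈Φ : (β : 𝔹) (i : Axis) → ∃ λ e → column (proj₁ β) i ≡ vec e
column-∈Φ ((β₁ , β₂ , β₃) , det≡1) i =
  satisfied (All.lookup (𝔹⇒columnsInΦ β₁ β₂ β₃ det≡1) (∈allAxes i))

open AbelianGroupProperties ℤ.+-0-abelianGroup using () renaming (\\-leftDividesˡ to n+[-n+m]≡m)

module _ (F : RealField) where
  open RealField F
  open Geometry F
  open IsCommutativeRing isCommutativeRing
    using (+-assoc; +-comm; +-identityˡ; +-identityʳ; -‿inverseʳ; zeroˡ; zeroʳ; *-identityʳ; distribˡ)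
  open IsStrictTotalOrder isStrictTotalOrder
    using (irrefl; compare; isStrictPartialOrder)

  commutativeRing : CommutativeRing _ _
  commutativeRing = record { isCommutativeRing = isCommutativeRing }

  open RingProperties (CommutativeRing.ring commutativeRing) using (-‿distribˡ-*; -‿distribʳ-*)
  open AbelianGroupProperties (CommutativeRing.+-abelianGroup commutativeRing)
    using (⁻¹-involutive; ε⁻¹≈ε; ⁻¹-∙-comm; ∙-cancelˡ; ∙-cancelʳ)
  open CommutativeSemigroupProperties (CommutativeRing.+-commutativeSemigroup commutativeRing)
    using (interchange; x∙yz≈y∙xz; xy∙z≈xz∙y)

  strictPartialOrder : StrictPartialOrder _ _ _
  strictPartialOrder = record { isStrictPartialOrder = isStrictPartialOrder }

  open StrictReasoning strictPartialOrder

  -x≡0⇒x≡0 : ∀ {x} → - x ≡ 0r → x ≡ 0r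
  -x≡0⇒x≡0 {x} h = trans (sym (⁻¹-involutive x)) (trans (cong -_ h) ε⁻¹≈ε)

  -x*-x≡x*x : ∀ x → (- x) * (- x) ≡ x * x
  -x*-x≡x*x x = begin-equality
    (- x) * (- x)     ≡⟨ -‿distribˡ-* x (- x) ⟨
    - (x * (- x))     ≡⟨ cong -_ (-‿distribʳ-* x x) ⟨
    - (- (x * x))     ≡⟨ ⁻¹-involutive (x * x) ⟩
    x * x             ∎

  x+s*[x-x]≡x : ∀ x s → x + s * (x + - x) ≡ x
  x+s*[x-x]≡x x s = begin-equality
    x + s * (x + - x) ≡⟨ cong (λ d → x + s * d) (-‿inverseʳ x) ⟩
    x + s * 0r        ≡⟨ cong (x +_) (zeroʳ s) ⟩
    x + 0r            ≡⟨ +-identityʳ x ⟩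
    x                 ∎

  fromℕ-+ : ∀ m n → fromℕ (m ℕ.+ n) ≡ fromℕ m + fromℕ n
  fromℕ-+ zero    n = sym (+-identityˡ (fromℕ n))
  fromℕ-+ (suc m) n = trans (cong (1r +_) (fromℕ-+ m n)) (sym (+-assoc 1r (fromℕ m) (fromℕ n)))

  fromℤ-⊖ : ∀ m n → fromℤ (m ℤ.⊖ n) ≡ fromℕ m + - fromℕ n
  fromℤ-⊖ m zero = begin-equality
    fromℤ (m ℤ.⊖ 0)     ≡⟨ cong fromℤ (ℤ.⊖-≥ {m} {0} z≤n) ⟩
    fromℕ m             ≡⟨ +-identityʳ (fromℕ m) ⟨
    fromℕ m + 0r        ≡⟨ cong (fromℕ m +_) ε⁻¹≈ε ⟨
    fromℕ m + - 0r      ∎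
  fromℤ-⊖ zero (suc n) = begin-equality
    fromℤ (0 ℤ.⊖ suc n)         ≡⟨ cong fromℤ (ℤ.⊖-< {0} {suc n} (s≤s z≤n)) ⟩
    - fromℕ (suc n)             ≡⟨ +-identityˡ _ ⟨
    0r + - fromℕ (suc n)        ∎
  fromℤ-⊖ (suc m) (suc n) = begin-equality
    fromℤ (suc m ℤ.⊖ suc n)                 ≡⟨ cong fromℤ (ℤ.[1+m]⊖[1+n]≡m⊖n m n) ⟩
    fromℤ (m ℤ.⊖ n)                         ≡⟨ fromℤ-⊖ m n ⟩
    fromℕ m + - fromℕ n                     ≡⟨ +-identityˡ _ ⟨
    0r + (fromℕ m + - fromℕ n)              ≡⟨ cong (_+ (fromℕ m + - fromℕ n)) (-‿inverseʳ 1r) ⟨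
    (1r + - 1r) + (fromℕ m + - fromℕ n)     ≡⟨ interchange 1r (- 1r) (fromℕ m) (- fromℕ n) ⟩
    (1r + fromℕ m) + (- 1r + - fromℕ n)     ≡⟨ cong ((1r + fromℕ m) +_) (⁻¹-∙-comm 1r (fromℕ n)) ⟩
    (1r + fromℕ m) + - (1r + fromℕ n)       ∎

  fromℤ-+ : ∀ m n → fromℤ (m ℤ.+ n) ≡ fromℤ m + fromℤ n
  fromℤ-+ (ℤ.+ m)  (ℤ.+ n)  = fromℕ-+ m n
  fromℤ-+ (ℤ.+ m)  -[1+ n ] = fromℤ-⊖ m (suc n)
  fromℤ-+ -[1+ m ] (ℤ.+ n)  = trans (fromℤ-⊖ n (suc m)) (+-comm (fromℕ n) _)
  fromℤ-+ -[1+ m ] -[1+ n ] = begin-equality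
    - (1r + fromℕ (suc m ℕ.+ n))        ≡⟨ cong (λ x → - (1r + x)) (fromℕ-+ (suc m) n) ⟩
    - (1r + (fromℕ (suc m) + fromℕ n))  ≡⟨ cong -_ (x∙yz≈y∙xz 1r (fromℕ (suc m)) (fromℕ n)) ⟩
    - (fromℕ (suc m) + fromℕ (suc n))   ≡⟨ ⁻¹-∙-comm (fromℕ (suc m)) (fromℕ (suc n)) ⟨
    - fromℕ (suc m) + - fromℕ (suc n)   ∎

  +-mono-≤ : ∀ {x y} z → x ≤ y → x + z ≤ y + z
  +-mono-≤ z (inj₁ x<y)  = inj₁ (+-mono-< z x<y)
  +-mono-≤ z (inj₂ refl) = inj₂ refl

  x≤y+x : ∀ x {y} → 0r ≤ y → x ≤ y + x
  x≤y+x x {y} 0≤y = begin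
    x        ≡⟨ +-identityˡ x ⟨
    0r + x   ≤⟨ +-mono-≤ x 0≤y ⟩
    y + x    ∎

  x≤x+y : ∀ x {y} → 0r ≤ y → x ≤ x + y
  x≤x+y x {y} 0≤y = begin
    x        ≤⟨ x≤y+x x 0≤y ⟩
    y + x    ≡⟨ +-comm y x ⟩
    x + y    ∎

  0<-x : ∀ {x} → x < 0r → 0r < - x
  0<-x {x} x<0 = begin-strict
    0r        ≡⟨ -‿inverseʳ x ⟨
    x + - x   <⟨ +-mono-< (- x) x<0 ⟩
    0r + - x  ≡⟨ +-identityˡ (- x) ⟩
    - x       ∎

  -- If 1 < 0 then 0 < −1, so 0 < (−1)(−1) = 1.
  0<1 : 0r < 1r
  0<1 with compare 0r 1r
  ... | tri< 0<1 _ _ = 0<1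
  ... | tri≈ _ 0≡1 _ = ⊥-elim (0≢1 0≡1)
  ... | tri> _ _ 1<0 = ⊥-elim (irrefl refl (begin-strict
    0r               <⟨ *-pos (0<-x 1<0) (0<-x 1<0) ⟩
    (- 1r) * (- 1r)  ≡⟨ -x*-x≡x*x 1r ⟩
    1r * 1r          ≡⟨ *-identityʳ 1r ⟩
    1r               <⟨ 1<0 ⟩
    0r               ∎))

  0≤x*x : ∀ x → 0r ≤ x * x
  0≤x*x x with compare 0r x
  ... | tri< 0<x _ _ = inj₁ (*-pos 0<x 0<x)
  ... | tri≈ _ refl _ = inj₂ (sym (zeroˡ 0r))
  ... | tri> _ _ x<0 = inj₁ (subst (0r <_) (-x*-x≡x*x x) (*-pos (0<-x x<0) (0<-x x<0)))

  0≤x*y : ∀ {x y} → 0r < x → 0r ≤ y → 0r ≤ x * y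
  0≤x*y 0<x (inj₁ 0<y)   = inj₁ (*-pos 0<x 0<y)
  0≤x*y {x} _ (inj₂ refl) = inj₂ (sym (zeroʳ x))

  coord²≤normSq : ∀ i v → coord i v * coord i v ≤ normSq v
  coord²≤normSq X (p , q , r) = begin
    p * p                   ≤⟨ x≤x+y (p * p) (0≤x*x q) ⟩
    p * p + q * q           ≤⟨ x≤x+y _ (0≤x*x r) ⟩
    p * p + q * q + r * r   ∎
  coord²≤normSq Y (p , q , r) = begin
    q * q                   ≤⟨ x≤y+x (q * q) (0≤x*x p) ⟩
    p * p + q * q           ≤⟨ x≤x+y _ (0≤x*x r) ⟩
    p * p + q * q + r * r   ∎
  coord²≤normSq Z (p , q , r) = x≤y+x (r * r) (begin
    0r                      ≤⟨ 0≤x*x p ⟩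
    p * p                   ≤⟨ x≤x+y (p * p) (0≤x*x q) ⟩
    p * p + q * q           ∎)

  0≤fromℕ : ∀ n → 0r ≤ fromℕ n
  0<fromℕ[1+n] : ∀ n → 0r < fromℕ (suc n)

  0≤fromℕ zero    = inj₂ refl
  0≤fromℕ (suc n) = inj₁ (0<fromℕ[1+n] n)

  0<fromℕ[1+n] n = begin-strict
    0r            <⟨ 0<1 ⟩
    1r            ≤⟨ x≤x+y 1r (0≤fromℕ n) ⟩
    1r + fromℕ n  ∎

  1≤fromℕ[1+n]² : ∀ n → 1r ≤ fromℕ (suc n) * fromℕ (suc n)
  1≤fromℕ[1+n]² n = begin
    1r                    ≤⟨ x≤x+y 1r (0≤fromℕ n) ⟩
    x                     ≤⟨ x≤x+y x (0≤x*y (0<fromℕ[1+n] n) (0≤fromℕ n)) ⟩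
    x + x * fromℕ n       ≡⟨ cong (_+ x * fromℕ n) (*-identityʳ x) ⟨
    x * 1r + x * fromℕ n  ≡⟨ distribˡ x 1r (fromℕ n) ⟨
    x * x                 ∎
    where x = fromℕ (suc n)

  fromℤ²<1⇒fromℤ≡0 : ∀ d → fromℤ d * fromℤ d < 1r → fromℤ d ≡ 0r
  fromℤ²<1⇒fromℤ≡0 (ℤ.+ zero)  _    = refl
  fromℤ²<1⇒fromℤ≡0 (ℤ.+ suc n) d²<1 = ⊥-elim (irrefl refl (begin-strict
    1r                                     ≤⟨ 1≤fromℕ[1+n]² n ⟩
    fromℕ (suc n) * fromℕ (suc n)          <⟨ d²<1 ⟩
    1r                                     ∎))
  fromℤ²<1⇒fromℤ≡0 -[1+ n ] d²<1 = ⊥-elim (irrefl refl (begin-strict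
    1r                                     ≤⟨ 1≤fromℕ[1+n]² n ⟩
    fromℕ (suc n) * fromℕ (suc n)          ≡⟨ -x*-x≡x*x (fromℕ (suc n)) ⟨
    (- fromℕ (suc n)) * (- fromℕ (suc n))  <⟨ d²<1 ⟩
    1r                                     ∎))

  coord-centre : ∀ i p → coord i (centre p) ≡ fromℤ (coord i p) + half
  coord-centre X p = refl
  coord-centre Y p = refl
  coord-centre Z p = refl

  coord-⊕ : ∀ i v w → coord i (v ⊕ w) ≡ coord i v + coord i w
  coord-⊕ X v w = refl
  coord-⊕ Y v w = refl
  coord-⊕ Z v w = refl

  coord-segment : ∀ i p q s → coord i (p ⊕ (s ⊙ (q ⊕ (⊖ p)))) ≡ coord i p + s * (coord i q + - coord i p)
  coord-segment X p q s = refl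
  coord-segment Y p q s = refl
  coord-segment Z p q s = refl

  coord-point-off-axis : ∀ {reg} (γ : Curve reg) k s {i} → axis (direction γ k) ≢ i →
                         coord i (point γ k s) ≡ coord i (centre (Curve.cube γ (inject₁ k)))
  coord-point-off-axis γ k s {i} off = begin-equality
    coord i (point γ k s)                      ≡⟨ coord-segment i p q s ⟩
    coord i p + s * (coord i q + - coord i p)  ≡⟨ cong (λ y → coord i p + s * (y + - coord i p)) qᵢ≡pᵢ ⟩
    coord i p + s * (coord i p + - coord i p)  ≡⟨ x+s*[x-x]≡x (coord i p) s ⟩
    coord i p                                  ∎
    where
    open Curve γ
    e = direction γ k
    P = cube (inject₁ k)
    p = centre P
    q = centre (cube (fsuc k))
    qᵢ≡pᵢ : coord i q ≡ coord i p
    qᵢ≡pᵢ = begin-equality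
      coord i q                              ≡⟨ cong (coord i ∘ centre) (proj₂ (adjacent k)) ⟩
      coord i (centre (P +ℤ³ vec e))         ≡⟨ coord-centre i (P +ℤ³ vec e) ⟩
      fromℤ (coord i (P +ℤ³ vec e)) + half   ≡⟨ cong (λ z → fromℤ z + half) (coord-step-off-axis e off P) ⟩
      fromℤ (coord i P) + half               ≡⟨ coord-centre i P ⟨
      coord i p                              ∎

  half-integer-shift : ∀ m n w → fromℤ m + half ≡ (fromℤ n + half) + w → w ≡ fromℤ (ℤ.- n ℤ.+ m)
  half-integer-shift m n w shift = ∙-cancelˡ (fromℤ n) w (fromℤ d) (begin-equality
    fromℤ n + w          ≡⟨ ∙-cancelʳ half _ _ (trans (xy∙z≈xz∙y (fromℤ n) w half) (sym shift)) ⟩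
    fromℤ m              ≡⟨ cong fromℤ (n+[-n+m]≡m n m) ⟨
    fromℤ (n ℤ.+ d)      ≡⟨ fromℤ-+ n d ⟩
    fromℤ n + fromℤ d    ∎)
    where d = ℤ.- n ℤ.+ m

  translate-coord-integral : ∀ {reg} (γ : Curve reg) k l s t u → point γ k s ≡ point γ l t ⊕ u →
                             ∃ λ i → ∃ λ d → coord i u ≡ fromℤ d
  translate-coord-integral γ k l s t u γ≡γ+u =
    i , ℤ.- coord i Q ℤ.+ coord i P , half-integer-shift (coord i P) (coord i Q) (coord i u) (begin-equality
      fromℤ (coord i P) + half                  ≡⟨ coord-centre i P ⟨
      coord i (centre P)                        ≡⟨ coord-point-off-axis γ k s offₖ ⟨
      coord i (point γ k s)                     ≡⟨ cong (coord i) γ≡γ+u ⟩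
      coord i (point γ l t ⊕ u)                 ≡⟨ coord-⊕ i (point γ l t) u ⟩
      coord i (point γ l t) + coord i u         ≡⟨ cong (_+ coord i u) (coord-point-off-axis γ l t offₗ) ⟩
      coord i (centre Q) + coord i u            ≡⟨ cong (_+ coord i u) (coord-centre i Q) ⟩
      (fromℤ (coord i Q) + half) + coord i u    ∎)
    where
    P = Curve.cube γ (inject₁ k)
    Q = Curve.cube γ (inject₁ l)
    third = thirdAxis (axis (direction γ k)) (axis (direction γ l))
    i = proj₁ third
    offₖ = proj₁ (proj₂ third)
    offₗ = proj₂ (proj₂ third)

  dot : ℝ³ → ℝ³ → Carrier
  dot (a , b , c) (x , y , z) = a * x + b * y + c * z

  coord-combo : ∀ β i a b c → coord i (combo β a b c) ≡ dot (a , b , c) (embed (column (proj₁ β) i))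
  coord-combo β X a b c = refl
  coord-combo β Y a b c = refl
  coord-combo β Z a b c = refl

  dot-e₁ : ∀ a b c x → dot (a , b , c) (x , 0r , 0r) ≡ a * x
  dot-e₁ a b c x = begin-equality
    a * x + b * 0r + c * 0r  ≡⟨ cong₂ (λ p q → a * x + p + q) (zeroʳ b) (zeroʳ c) ⟩
    a * x + 0r + 0r          ≡⟨ trans (+-identityʳ _) (+-identityʳ _) ⟩
    a * x                    ∎

  dot-e₂ : ∀ a b c x → dot (a , b , c) (0r , x , 0r) ≡ b * x
  dot-e₂ a b c x = begin-equality
    a * 0r + b * x + c * 0r  ≡⟨ cong₂ (λ p q → p + b * x + q) (zeroʳ a) (zeroʳ c) ⟩
    0r + b * x + 0r          ≡⟨ trans (+-identityʳ _) (+-identityˡ _) ⟩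
    b * x                    ∎

  dot-e₃ : ∀ a b c x → dot (a , b , c) (0r , 0r , x) ≡ c * x
  dot-e₃ a b c x = begin-equality
    a * 0r + b * 0r + c * x  ≡⟨ cong₂ (λ p q → p + q + c * x) (zeroʳ a) (zeroʳ b) ⟩
    0r + 0r + c * x          ≡⟨ trans (cong (_+ c * x) (+-identityʳ 0r)) (+-identityˡ _) ⟩
    c * x                    ∎

  x*1≡x : ∀ x → x * fromℤ ℤ.1ℤ ≡ x
  x*1≡x x = trans (cong (x *_) (+-identityʳ 1r)) (*-identityʳ x)

  x*-1≡0⇒x≡0 : ∀ {x} → x * fromℤ ℤ.-1ℤ ≡ 0r → x ≡ 0r
  x*-1≡0⇒x≡0 {x} h = -x≡0⇒x≡0 (trans (cong -_ (sym (x*1≡x x))) (trans (-‿distribʳ-* x _) h))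

  dot-vec-zero : ∀ e v → dot v (embed (vec e)) ≡ 0r → coord (axis e) v ≡ 0r
  dot-vec-zero +ex (a , b , c) = trans (sym (trans (dot-e₁ a b c _) (x*1≡x a)))
  dot-vec-zero -ex (a , b , c) = x*-1≡0⇒x≡0 ∘ trans (sym (dot-e₁ a b c _))
  dot-vec-zero +ey (a , b , c) = trans (sym (trans (dot-e₂ a b c _) (x*1≡x b)))
  dot-vec-zero -ey (a , b , c) = x*-1≡0⇒x≡0 ∘ trans (sym (dot-e₂ a b c _))
  dot-vec-zero +ez (a , b , c) = trans (sym (trans (dot-e₃ a b c _) (x*1≡x c)))
  dot-vec-zero -ez (a , b , c) = x*-1≡0⇒x≡0 ∘ trans (sym (dot-e₃ a b c _))

  coord-zero⇒product-zero : ∀ i a b c → coord i (a , b , c) ≡ 0r → a * b * c ≡ 0r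
  coord-zero⇒product-zero X a b c refl = trans (cong (_* c) (zeroˡ b)) (zeroˡ c)
  coord-zero⇒product-zero Y a b c refl = trans (cong (_* c) (zeroʳ a)) (zeroˡ c)
  coord-zero⇒product-zero Z a b c refl = zeroʳ (a * b)

  combo-coord-zero : ∀ β i a b c → coord i (combo β a b c) ≡ 0r → a * b * c ≡ 0r
  combo-coord-zero β i a b c uᵢ≡0 =
    coord-zero⇒product-zero (axis e) a b c (dot-vec-zero e (a , b , c) (begin-equality
      dot (a , b , c) (embed (vec e))                  ≡⟨ cong (dot (a , b , c) ∘ embed) column≡e ⟨
      dot (a , b , c) (embed (column (proj₁ β) i))     ≡⟨ coord-combo β i a b c ⟨
      coord i (combo β a b c)                          ≡⟨ uᵢ≡0 ⟩
      0r                                               ∎))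
    where
    e = proj₁ (column-∈Φ β i)
    column≡e = proj₂ (column-∈Φ β i)

lemma4p5 : (F : RealField) → Lemma4p5 F
lemma4p5 F reg γ β a b c ‖u‖²<1 abc≢0 k l s t _ _ γ≡γ+u =
  abc≢0 (combo-coord-zero F β i a b c (trans uᵢ≡d (fromℤ²<1⇒fromℤ≡0 F d d²<1)))
  where
  open RealField F
  open Geometry F
  open StrictReasoning (strictPartialOrder F)
  u = combo β a b c
  integral = translate-coord-integral F γ k l s t u γ≡γ+u
  i = proj₁ integral
  d = proj₁ (proj₂ integral)
  uᵢ≡d : coord i u ≡ fromℤ d
  uᵢ≡d = proj₂ (proj₂ integral)
  d²<1 : fromℤ d * fromℤ d < 1r
  d²<1 = begin-strict
    fromℤ d * fromℤ d       ≡⟨ cong₂ _*_ uᵢ≡d uᵢ≡d ⟨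
    coord i u * coord i u   ≤⟨ coord²≤normSq F i u ⟩
    normSq u                <⟨ ‖u‖²<1 ⟩
    1r                      ∎
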